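{- Let $A$ be a commutative unitary ring, let $n\ge1$, and let $(a_1,\dots,a_n)\in A^n$ be such that $K_n(a_1,\dots,a_n)=\epsilon\in\{\pm1_A\}$. Set $x=\epsilon K_{n-1}(a_2,\dots,a_n)$ and $y=\epsilon K_{n-1}(a_1,\dots,a_{n-1})$. Then $M_{n+2}(x,a_1,\dots,a_n,y)=-\epsilon\,\mathrm{Id}$.
   Context: For $a_1,\dots,a_m\in A$, set $M_m(a_1,\ldots,a_m)=\begin{pmatrix} a_m & -1_A\\ 1_A & 0_A\end{pmatrix}\cdots\begin{pmatrix} a_1 & -1_A\\ 1_A & 0_A\end{pmatrix}$. The continuants are defined by $K_{ -1}=0_A$ and $K_0=1_A$ (the value on the empty tuple). For $i\ge1$, $K_i(a_1,\dots,a_i)$ is the determinant of the $i\times i$ tridiagonal matrix with diagonal $a_1,\dots,a_i$ and all sub- and super-diagonal entries equal to $1_A$. -}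

module Defs where

open import Level using (Level)
open import Algebra.Bundles using (CommutativeRing)
open import Data.Nat using (ℕ; zero; suc; _≟_)
open import Data.Fin using (Fin; punchIn; toℕ) renaming (zero to fzero; suc to fsuc)
open import Data.Vec using (Vec; []; _∷_; lookup; foldr)
open import Data.Product using (_×_; _,_)
open import Relation.Nullary using (yes; no)

module _ {c ℓ : Level} (R : CommutativeRing c ℓ) where
  open CommutativeRing R

  record Mat2 : Set c where
    constructor mat
    field
      m11 m12 m21 m22 : Carrier

  _⊗_ : Mat2 → Mat2 → Mat2
  mat a b c' d ⊗ mat e f g h =
    mat (a * e + b * g) (a * f + b * h) (c' * e + d * g) (c' * f + d * h)

  _≈M_ : Mat2 → Mat2 → Set ℓ
  mat a b c' d ≈M mat e f g h = (a ≈ e) × (b ≈ f) × (c' ≈ g) × (d ≈ h)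

  idM : Mat2
  idM = mat 1# 0# 0# 1#

  scaleM : Carrier → Mat2 → Mat2
  scaleM k (mat a b c' d) = mat (k * a) (k * b) (k * c') (k * d)

  E : Carrier → Mat2
  E a = mat a (- 1#) 1# 0#

  -- M_m(a_1,...,a_m) = E(a_m) ⋯ E(a_1)
  M : ∀ {m} → Vec Carrier m → Mat2
  M []       = idM
  M (a ∷ as) = M as ⊗ E a

  minor : ∀ {n} → Fin (suc n) → (Fin (suc n) → Fin (suc n) → Carrier)
        → Fin n → Fin n → Carrier
  minor j A r s = A (fsuc r) (punchIn j s)

  sign : ℕ → Carrier
  sign zero    = 1#
  sign (suc k) = - sign k

  sumFin : ∀ {n} → (Fin n → Carrier) → Carrier
  sumFin {zero}  f = 0#
  sumFin {suc n} f = f fzero + sumFin (λ i → f (fsuc i))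

  det : ∀ {n} → (Fin n → Fin n → Carrier) → Carrier
  det {zero}  A = 1#
  det {suc n} A = sumFin (λ j → sign (toℕ j) * A fzero j * det (minor j A))

  tridiag : ∀ {i} → Vec Carrier i → Fin i → Fin i → Carrier
  tridiag as r s with toℕ r ≟ toℕ s | suc (toℕ r) ≟ toℕ s | toℕ r ≟ suc (toℕ s)
  ... | yes _ | _     | _     = lookup as r
  ... | no _  | yes _ | _     = 1#
  ... | no _  | no _  | yes _ = 1#
  ... | no _  | no _  | no _  = 0#

  K : ∀ {i} → Vec Carrier i → Carrier
  K as = det (tridiag as)

-- Expanding the tridiagonal determinant along its first row gives the recurrence
-- Kₙ(a₁,…,aₙ) = a₁ Kₙ₋₁(a₂,…,aₙ) − Kₙ₋₂(a₃,…,aₙ). With it, by induction M(a₁,…,aₙ) has first row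
-- (Kₙ(a₁,…,aₙ), −Kₙ₋₁(a₂,…,aₙ)), its second row is the first row of M(a₁,…,aₙ₋₁), and it has
-- determinant 1. So for N = M(a₁,…,aₙ) the first row is (ε, −εx) and the first column is (ε, εy).
-- Multiplying on the right by E(x) clears the top-left entry, the determinant condition then
-- forces N E(x) = (0 −ε / ε −εy), and multiplying on the left by E(y) leaves −ε Id.
module Submission where

open import Defs
open import Level using (Level)
open import Algebra.Bundles using (CommutativeRing)
open import Data.Nat using (ℕ; zero; suc; _≟_)
open import Data.Fin using (Fin; toℕ; punchIn) renaming (zero to fzero; suc to fsuc)
open import Data.Vec using (Vec; []; _∷_; lookup; tail; init; _++_; [_])
open import Data.Product using (_×_; _,_; proj₁; proj₂)
open import Data.Sum using (_⊎_; inj₁; inj₂)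
open import Data.Empty using (⊥-elim)
open import Function using (_∘_)
open import Relation.Nullary using (¬_; yes; no)
open import Relation.Binary.Bundles using (Setoid)
open import Relation.Binary.PropositionalEquality using (_≡_)
import Relation.Binary.PropositionalEquality as ≡
import Algebra.Properties.Ring as RingProperties
import Algebra.Properties.CommutativeSemigroup as CommutativeSemigroupProperties
import Relation.Binary.Reasoning.Setoid as SetoidReasoning

module Continuants {c ℓ : Level} (R : CommutativeRing c ℓ) where
  open CommutativeRing R hiding (zero)
  open RingProperties ring using (-1*x≈-x; -‿distribˡ-*; -‿distribʳ-*; -‿involutive; -0#≈0#; -‿+-comm)
  open CommutativeSemigroupProperties +-commutativeSemigroup using (interchange)
  open CommutativeSemigroupProperties *-commutativeSemigroup using (x∙yz≈y∙xz)
  open SetoidReasoning setoid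

  zero-middle : ∀ {a b c′} → b ≈ 0# → a * b * c′ ≈ 0#
  zero-middle {a} {b} {c′} b≈0 = begin
    a * b * c′  ≈⟨ *-congʳ (trans (*-congˡ b≈0) (zeroʳ a)) ⟩
    0# * c′     ≈⟨ zeroˡ c′ ⟩
    0#          ∎

  zero-last : ∀ {a b c′} → c′ ≈ 0# → a * b * c′ ≈ 0#
  zero-last c≈0 = trans (*-congˡ c≈0) (zeroʳ _)

  1*x+0*y≈x : ∀ x y → 1# * x + 0# * y ≈ x
  1*x+0*y≈x x y = trans (+-cong (*-identityˡ x) (zeroˡ y)) (+-identityʳ x)

  0*x+1*y≈y : ∀ x y → 0# * x + 1# * y ≈ y
  0*x+1*y≈y x y = trans (+-cong (zeroˡ x) (*-identityˡ y)) (+-identityˡ y)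

  x*1+y*0≈x : ∀ x y → x * 1# + y * 0# ≈ x
  x*1+y*0≈x x y = trans (+-cong (*-identityʳ x) (zeroʳ y)) (+-identityʳ x)

  x*0+y*1≈y : ∀ x y → x * 0# + y * 1# ≈ y
  x*0+y*1≈y x y = trans (+-cong (zeroʳ x) (*-identityʳ y)) (+-identityˡ y)

  x*-1+y*0≈-x : ∀ x y → x * - 1# + y * 0# ≈ - x
  x*-1+y*0≈-x x y = begin
    x * - 1# + y * 0# ≈⟨ +-cong (sym (-‿distribʳ-* x 1#)) (zeroʳ y) ⟩
    - (x * 1#) + 0#   ≈⟨ +-identityʳ _ ⟩
    - (x * 1#)        ≈⟨ -‿cong (*-identityʳ x) ⟩
    - x               ∎

  sumFin-cong : ∀ {n} {f g : Fin n → Carrier} → (∀ i → f i ≈ g i) → sumFin R f ≈ sumFin R g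
  sumFin-cong {zero}  f≈g = refl
  sumFin-cong {suc n} f≈g = +-cong (f≈g fzero) (sumFin-cong (f≈g ∘ fsuc))

  sumFin-zero : ∀ {n} {f : Fin n → Carrier} → (∀ i → f i ≈ 0#) → sumFin R f ≈ 0#
  sumFin-zero {zero}  f≈0 = refl
  sumFin-zero {suc n} f≈0 = trans (+-cong (f≈0 fzero) (sumFin-zero (f≈0 ∘ fsuc))) (+-identityʳ 0#)

  cofactorTerm : ∀ {n} → (Fin (suc n) → Fin (suc n) → Carrier) → Fin (suc n) → Carrier
  cofactorTerm A j = sign R (toℕ j) * A fzero j * det R (minor R j A)

  det-cong : ∀ {n} {A B : Fin n → Fin n → Carrier} → (∀ r s → A r s ≈ B r s) → det R A ≈ det R B
  det-cong {zero}  A≈B = refl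
  det-cong {suc n} {A} {B} A≈B = sumFin-cong {f = cofactorTerm A} {g = cofactorTerm B} λ j →
    *-cong (*-congˡ (A≈B fzero j)) (det-cong λ r s → A≈B (fsuc r) (punchIn j s))

  det-1×1 : (A : Fin 1 → Fin 1 → Carrier) → det R A ≈ A fzero fzero
  det-1×1 A = trans (+-identityʳ _) (trans (*-identityʳ _) (*-identityˡ _))

  det-firstColumn-zero : ∀ {n} (A : Fin (suc n) → Fin (suc n) → Carrier) →
                         (∀ r → A r fzero ≈ 0#) → det R A ≈ 0#
  det-firstColumn-zero {zero}  A col≈0 = sumFin-zero {f = cofactorTerm A} λ
    { fzero    → zero-middle (col≈0 fzero)
    ; (fsuc ())
    }
  det-firstColumn-zero {suc n} A col≈0 = sumFin-zero {f = cofactorTerm A} λ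
    { fzero    → zero-middle (col≈0 fzero)
    ; (fsuc j) → zero-last (det-firstColumn-zero (minor R (fsuc j) A) (col≈0 ∘ fsuc))
    }

  det-firstRow₂ : ∀ {n} (A : Fin (suc (suc n)) → Fin (suc (suc n)) → Carrier) →
                  (∀ j → A fzero (fsuc (fsuc j)) ≈ 0#) →
                  det R A ≈ A fzero fzero * det R (minor R fzero A)
                            - A fzero (fsuc fzero) * det R (minor R (fsuc fzero) A)
  det-firstRow₂ A row≈0 = begin
    1# * a * d₀ + (- 1# * b * d₁ + sumFin R (cofactorTerm A ∘ fsuc ∘ fsuc))
      ≈⟨ +-cong (*-congʳ (*-identityˡ a))
                (trans (+-congˡ (sumFin-zero λ j → zero-middle (row≈0 j))) (+-identityʳ _)) ⟩
    a * d₀ + - 1# * b * d₁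
      ≈⟨ +-congˡ (trans (*-congʳ (-1*x≈-x b)) (sym (-‿distribˡ-* b d₁))) ⟩
    a * d₀ - b * d₁ ∎
    where
    a = A fzero fzero
    b = A fzero (fsuc fzero)
    d₀ = det R (minor R fzero A)
    d₁ = det R (minor R (fsuc fzero) A)

  -- Indexed by ℕ so that deleting the first row and column of bandMatrix (suc n) d gives
  -- bandMatrix n (d ∘ suc) definitionally.

  band : (ℕ → Carrier) → ℕ → ℕ → Carrier
  band d zero          zero          = d zero
  band d zero          (suc zero)    = 1#
  band d zero          (suc (suc j)) = 0#
  band d (suc i)       (suc j)       = band (d ∘ suc) i j
  band d (suc zero)    zero          = 1#
  band d (suc (suc i)) zero          = 0#

  bandMatrix : ∀ n → (ℕ → Carrier) → Fin n → Fin n → Carrier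
  bandMatrix n d r s = band d (toℕ r) (toℕ s)

  band-diagonal : ∀ d {i j} → i ≡ j → band d i j ≡ d i
  band-diagonal d {zero}  ≡.refl = ≡.refl
  band-diagonal d {suc i} ≡.refl = band-diagonal (d ∘ suc) {i} ≡.refl

  band-above : ∀ d {i j} → suc i ≡ j → band d i j ≡ 1#
  band-above d {zero}  ≡.refl = ≡.refl
  band-above d {suc i} ≡.refl = band-above (d ∘ suc) {i} ≡.refl

  band-below : ∀ d {i j} → i ≡ suc j → band d i j ≡ 1#
  band-below d {j = zero}  ≡.refl = ≡.refl
  band-below d {j = suc j} ≡.refl = band-below (d ∘ suc) {j = j} ≡.refl

  band-far : ∀ d i j → ¬ i ≡ j → ¬ suc i ≡ j → ¬ i ≡ suc j → band d i j ≡ 0#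
  band-far d zero          zero          i≢j _ _ = ⊥-elim (i≢j ≡.refl)
  band-far d zero          (suc zero)    _ i≢j _ = ⊥-elim (i≢j ≡.refl)
  band-far d zero          (suc (suc j)) _ _ _   = ≡.refl
  band-far d (suc i)       (suc j)       p q r   =
    band-far (d ∘ suc) i j (p ∘ ≡.cong suc) (q ∘ ≡.cong suc) (r ∘ ≡.cong suc)
  band-far d (suc zero)    zero          _ _ i≢j = ⊥-elim (i≢j ≡.refl)
  band-far d (suc (suc i)) zero          _ _ _   = ≡.refl

  padded : ∀ {n} → Vec Carrier n → ℕ → Carrier
  padded []       _       = 0#
  padded (a ∷ as) zero    = a
  padded (a ∷ as) (suc k) = padded as k

  lookup-padded : ∀ {n} (as : Vec Carrier n) r → lookup as r ≡ padded as (toℕ r)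
  lookup-padded (a ∷ as) fzero    = ≡.refl
  lookup-padded (a ∷ as) (fsuc r) = lookup-padded as r

  tridiag≡band : ∀ {n} (as : Vec Carrier n) r s → tridiag R as r s ≡ bandMatrix n (padded as) r s
  tridiag≡band as r s with toℕ r ≟ toℕ s | suc (toℕ r) ≟ toℕ s | toℕ r ≟ suc (toℕ s)
  ... | yes p | _     | _     = ≡.trans (lookup-padded as r) (≡.sym (band-diagonal _ p))
  ... | no _  | yes q | _     = ≡.sym (band-above _ q)
  ... | no _  | no _  | yes e = ≡.sym (band-below _ e)
  ... | no p  | no q  | no e  = ≡.sym (band-far _ (toℕ r) (toℕ s) p q e)

  K≈det-band : ∀ {n} (as : Vec Carrier n) → K R as ≈ det R (bandMatrix n (padded as))
  K≈det-band as = det-cong λ r s → reflexive (tridiag≡band as r s)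

  -- This minor has first column (1, 0, …, 0), so its own minor at (1, 2) has a zero first column.
  det-band-minor₁ : ∀ n d → det R (minor R (fsuc fzero) (bandMatrix (suc (suc n)) d))
                          ≈ det R (bandMatrix n (d ∘ suc ∘ suc))
  det-band-minor₁ zero    d = det-1×1 (minor R (fsuc fzero) (bandMatrix 2 d))
  det-band-minor₁ (suc n) d = begin
    det R B                                         ≈⟨ det-firstRow₂ B (λ _ → refl) ⟩
    1# * det R (bandMatrix (suc n) (d ∘ suc ∘ suc)) - 1# * det R (minor R (fsuc fzero) B)
      ≈⟨ +-cong (*-identityˡ _) (-‿cong (trans (*-congˡ minor₁≈0) (zeroʳ 1#))) ⟩
    det R (bandMatrix (suc n) (d ∘ suc ∘ suc)) - 0# ≈⟨ trans (+-congˡ -0#≈0#) (+-identityʳ _) ⟩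
    det R (bandMatrix (suc n) (d ∘ suc ∘ suc))      ∎
    where
    B = minor R (fsuc fzero) (bandMatrix (suc (suc (suc n))) d)
    minor₁≈0 : det R (minor R (fsuc fzero) B) ≈ 0#
    minor₁≈0 = det-firstColumn-zero (minor R (fsuc fzero) B) λ _ → refl

  det-band-recurrence : ∀ n d → det R (bandMatrix (suc (suc n)) d)
                              ≈ d 0 * det R (bandMatrix (suc n) (d ∘ suc)) - det R (bandMatrix n (d ∘ suc ∘ suc))
  det-band-recurrence n d = trans (det-firstRow₂ (bandMatrix (suc (suc n)) d) λ _ → refl)
                                  (+-congˡ (-‿cong (trans (*-identityˡ _) (det-band-minor₁ n d))))

  K-[_] : ∀ a → K R [ a ] ≈ a
  K-[ a ] = det-1×1 (tridiag R [ a ])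

  K-∷∷ : ∀ {n} a b (w : Vec Carrier n) → K R (a ∷ b ∷ w) ≈ a * K R (b ∷ w) - K R w
  K-∷∷ {n} a b w = begin
    K R (a ∷ b ∷ w)                                       ≈⟨ K≈det-band (a ∷ b ∷ w) ⟩
    det R (bandMatrix (suc (suc n)) (padded (a ∷ b ∷ w))) ≈⟨ det-band-recurrence n _ ⟩
    a * det R (bandMatrix (suc n) (padded (b ∷ w))) - det R (bandMatrix n (padded w))
      ≈⟨ +-cong (*-congˡ (sym (K≈det-band (b ∷ w)))) (-‿cong (sym (K≈det-band w))) ⟩
    a * K R (b ∷ w) - K R w                               ∎

  open Mat2

  infixl 7 _·_
  _·_ : Mat2 R → Mat2 R → Mat2 R
  _·_ = _⊗_ R

  infix 4 _≃_
  _≃_ : Mat2 R → Mat2 R → Set ℓ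
  _≃_ = _≈M_ R

  Mat2-setoid : Setoid c ℓ
  Mat2-setoid = record
    { Carrier       = Mat2 R
    ; _≈_           = _≃_
    ; isEquivalence = record
      { refl  = refl , refl , refl , refl
      ; sym   = λ (p , q , r , s) → sym p , sym q , sym r , sym s
      ; trans = λ (p , q , r , s) (p′ , q′ , r′ , s′) → trans p p′ , trans q q′ , trans r r′ , trans s s′
      }
    }

  open Setoid Mat2-setoid public using () renaming (refl to ≃-refl; sym to ≃-sym; trans to ≃-trans)

  ·-cong : ∀ {X X′ Y Y′} → X ≃ X′ → Y ≃ Y′ → X · Y ≃ X′ · Y′
  ·-cong (p , q , r , s) (p′ , q′ , r′ , s′) =
    +-cong (*-cong p p′) (*-cong q r′) , +-cong (*-cong p q′) (*-cong q s′) ,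
    +-cong (*-cong r p′) (*-cong s r′) , +-cong (*-cong r q′) (*-cong s s′)

  ·-assoc : ∀ X Y Z → (X · Y) · Z ≃ X · (Y · Z)
  ·-assoc X Y Z = entry (m11 X) (m12 X) (m11 Z) (m21 Z) , entry (m11 X) (m12 X) (m12 Z) (m22 Z) ,
                  entry (m21 X) (m22 X) (m11 Z) (m21 Z) , entry (m21 X) (m22 X) (m12 Z) (m22 Z)
    where
    entry : ∀ a b i k → (a * m11 Y + b * m21 Y) * i + (a * m12 Y + b * m22 Y) * k
                      ≈ a * (m11 Y * i + m12 Y * k) + b * (m21 Y * i + m22 Y * k)
    entry a b i k = begin
      (a * m11 Y + b * m21 Y) * i + (a * m12 Y + b * m22 Y) * k
        ≈⟨ +-cong (distribʳ i _ _) (distribʳ k _ _) ⟩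
      (a * m11 Y * i + b * m21 Y * i) + (a * m12 Y * k + b * m22 Y * k)
        ≈⟨ interchange _ _ _ _ ⟩
      (a * m11 Y * i + a * m12 Y * k) + (b * m21 Y * i + b * m22 Y * k)
        ≈⟨ +-cong (+-cong (*-assoc _ _ _) (*-assoc _ _ _)) (+-cong (*-assoc _ _ _) (*-assoc _ _ _)) ⟩
      (a * (m11 Y * i) + a * (m12 Y * k)) + (b * (m21 Y * i) + b * (m22 Y * k))
        ≈⟨ +-cong (distribˡ a _ _) (distribˡ b _ _) ⟨
      a * (m11 Y * i + m12 Y * k) + b * (m21 Y * i + m22 Y * k) ∎

  ·-identityˡ : ∀ X → idM R · X ≃ X
  ·-identityˡ X = 1*x+0*y≈x _ _ , 1*x+0*y≈x _ _ , 0*x+1*y≈y _ _ , 0*x+1*y≈y _ _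

  ·-identityʳ : ∀ X → X · idM R ≃ X
  ·-identityʳ X = x*1+y*0≈x _ _ , x*0+y*1≈y _ _ , x*1+y*0≈x _ _ , x*0+y*1≈y _ _

  ·-E : ∀ X a → X · E R a ≃ mat (m11 X * a + m12 X) (- m11 X) (m21 X * a + m22 X) (- m21 X)
  ·-E X a = +-congˡ (*-identityʳ _) , x*-1+y*0≈-x _ _ , +-congˡ (*-identityʳ _) , x*-1+y*0≈-x _ _

  E-· : ∀ a X → E R a · X ≃ mat (a * m11 X - m21 X) (a * m12 X - m22 X) (m11 X) (m12 X)
  E-· a X = +-congˡ (-1*x≈-x _) , +-congˡ (-1*x≈-x _) , 1*x+0*y≈x _ _ , 1*x+0*y≈x _ _

  detM : Mat2 R → Carrier
  detM X = m11 X * m22 X - m12 X * m21 X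

  detM-cong : ∀ {X Y} → X ≃ Y → detM X ≈ detM Y
  detM-cong (p , q , r , s) = +-cong (*-cong p s) (-‿cong (*-cong q r))

  detM-·E : ∀ X a → detM (X · E R a) ≈ detM X
  detM-·E X a = trans (detM-cong (·-E X a)) (begin
    (p * a + q) * - r - - p * (r * a + s)
      ≈⟨ +-cong (sym (-‿distribʳ-* _ r)) (trans (-‿cong (sym (-‿distribˡ-* p _))) (-‿involutive _)) ⟩
    - ((p * a + q) * r) + p * (r * a + s)
      ≈⟨ +-cong (-‿cong (distribʳ r _ _)) (distribˡ p _ _) ⟩
    - (p * a * r + q * r) + (p * (r * a) + p * s)
      ≈⟨ +-cong (sym (-‿+-comm _ _)) (+-congʳ par≈) ⟩
    (- (p * a * r) + - (q * r)) + (p * a * r + p * s)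
      ≈⟨ interchange _ _ _ _ ⟩
    (- (p * a * r) + p * a * r) + (- (q * r) + p * s)
      ≈⟨ trans (+-congʳ (-‿inverseˡ _)) (+-identityˡ _) ⟩
    - (q * r) + p * s
      ≈⟨ +-comm _ _ ⟩
    p * s - q * r ∎)
    where
    p = m11 X
    q = m12 X
    r = m21 X
    s = m22 X
    par≈ : p * (r * a) ≈ p * a * r
    par≈ = trans (*-congˡ (*-comm r a)) (sym (*-assoc p a r))

  M-snoc : ∀ {n} (v : Vec Carrier n) y → M R (v ++ [ y ]) ≃ E R y · M R v
  M-snoc []      y = ≃-trans (·-identityˡ (E R y)) (≃-sym (·-identityʳ (E R y)))
  M-snoc (a ∷ v) y = ≃-trans (·-cong (M-snoc v y) ≃-refl) (·-assoc (E R y) (M R v) (E R a))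

  detM-M : ∀ {n} (v : Vec Carrier n) → detM (M R v) ≈ 1#
  detM-M []      = trans (+-cong (*-identityʳ 1#) (trans (-‿cong (zeroʳ 0#)) -0#≈0#)) (+-identityʳ 1#)
  detM-M (a ∷ v) = trans (detM-·E (M R v) a) (detM-M v)

  M-m11 : ∀ {n} (v : Vec Carrier n) → m11 (M R v) ≈ K R v
  M-m12 : ∀ {n} a (v : Vec Carrier n) → m12 (M R (a ∷ v)) ≈ - K R v

  M-m11 []          = refl
  M-m11 (a ∷ [])    = trans (1*x+0*y≈x a 1#) (sym K-[ a ])
  M-m11 (a ∷ b ∷ w) = begin
    m11 (M R (a ∷ b ∷ w))                     ≈⟨ proj₁ (·-E (M R (b ∷ w)) a) ⟩
    m11 (M R (b ∷ w)) * a + m12 (M R (b ∷ w))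
      ≈⟨ +-cong (trans (*-congʳ (M-m11 (b ∷ w))) (*-comm _ a)) (M-m12 b w) ⟩
    a * K R (b ∷ w) - K R w                   ≈⟨ K-∷∷ a b w ⟨
    K R (a ∷ b ∷ w)                           ∎

  M-m12 a v = trans (proj₁ (proj₂ (·-E (M R v) a))) (-‿cong (M-m11 v))

  -- E(aₙ) has second row (1 0), so the second row of M(a₁,…,aₙ) is the first row of M(a₁,…,aₙ₋₁).
  M-secondRow : ∀ {n} (v : Vec Carrier (suc n)) →
                m21 (M R v) ≈ m11 (M R (init v)) × m22 (M R v) ≈ m12 (M R (init v))
  M-secondRow (a ∷ [])    = 0*x+1*y≈y a 1# , 0*x+1*y≈y (- 1#) 0#
  M-secondRow (a ∷ b ∷ w) =
    let (r₁ , r₂) = M-secondRow (b ∷ w)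
        (_ , _ , e₂₁ , e₂₂) = ·-E (M R (b ∷ w)) a
        (e₁₁′ , e₁₂′ , _ , _) = ·-E (M R (init (b ∷ w))) a
    in trans e₂₁ (trans (+-cong (*-congʳ r₁) r₂) (sym e₁₁′)) , trans e₂₂ (trans (-‿cong r₁) (sym e₁₂′))

  M-m21 : ∀ {n} (v : Vec Carrier (suc n)) → m21 (M R v) ≈ K R (init v)
  M-m21 v = trans (proj₁ (M-secondRow v)) (M-m11 (init v))

  x≈±1⇒x*x≈1 : ∀ {x} → x ≈ 1# ⊎ x ≈ - 1# → x * x ≈ 1#
  x≈±1⇒x*x≈1 (inj₁ x≈1)  = trans (*-cong x≈1 x≈1) (*-identityʳ 1#)
  x≈±1⇒x*x≈1 (inj₂ x≈-1) = trans (*-cong x≈-1 x≈-1) (trans (-1*x≈-x (- 1#)) (-‿involutive 1#))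

  module _ {ε : Carrier} (εε≈1 : ε * ε ≈ 1#) where

    ε[εa]≈a : ∀ a → ε * (ε * a) ≈ a
    ε[εa]≈a a = trans (sym (*-assoc ε ε a)) (trans (*-congʳ εε≈1) (*-identityˡ a))

    ·E-clearCorner : ∀ {k l} N → detM N ≈ 1# → m11 N ≈ ε → m12 N ≈ - k → m21 N ≈ l →
                     N · E R (ε * k) ≃ mat 0# (- ε) ε (- l)
    ·E-clearCorner {k} {l} N detN≈1 m11≈ε m12≈-k m21≈l = ≃-trans (·-E N (ε * k))
      ( trans (+-cong (trans (*-congʳ m11≈ε) (ε[εa]≈a k)) m12≈-k) (-‿inverseʳ k)
      , -‿cong m11≈ε , m21*εk+s≈ε , -‿cong m21≈l )
      where
      s = m22 N

      εs+kl≈1 : ε * s + k * l ≈ 1#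
      εs+kl≈1 = trans (+-cong (*-congʳ (sym m11≈ε)) kl≈) detN≈1
        where
        kl≈ : k * l ≈ - (m12 N * m21 N)
        kl≈ = sym (trans (-‿cong (trans (*-cong m12≈-k m21≈l) (sym (-‿distribˡ-* k l)))) (-‿involutive _))

      m21*εk+s≈ε : m21 N * (ε * k) + s ≈ ε
      m21*εk+s≈ε = begin
        m21 N * (ε * k) + s       ≈⟨ +-cong (trans (*-congʳ m21≈l) (trans (x∙yz≈y∙xz l ε k) (*-congˡ (*-comm l k))))
                                            (sym (ε[εa]≈a s)) ⟩
        ε * (k * l) + ε * (ε * s) ≈⟨ distribˡ ε _ _ ⟨
        ε * (k * l + ε * s)       ≈⟨ *-congˡ (trans (+-comm _ _) εs+kl≈1) ⟩
        ε * 1#                    ≈⟨ *-identityʳ ε ⟩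
        ε                         ∎

    E-·-antidiagonal : ∀ l → E R (ε * l) · mat 0# (- ε) ε (- l) ≃ scaleM R (- ε) (idM R)
    E-·-antidiagonal l = ≃-trans (E-· (ε * l) (mat 0# (- ε) ε (- l)))
      (e₁₁ , e₁₂ , sym (zeroʳ _) , sym (*-identityʳ _))
      where
      y = ε * l

      e₁₁ : y * 0# - ε ≈ - ε * 1#
      e₁₁ = trans (trans (+-congʳ (zeroʳ y)) (+-identityˡ _)) (sym (*-identityʳ _))

      yε≈l : y * ε ≈ l
      yε≈l = trans (*-comm y ε) (ε[εa]≈a l)

      e₁₂ : y * - ε - - l ≈ - ε * 0#
      e₁₂ = trans (+-congʳ (trans (sym (-‿distribʳ-* y ε)) (-‿cong yε≈l)))
                  (trans (-‿inverseʳ (- l)) (sym (zeroʳ _)))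

lemma2p15 : {c ℓ : Level} (R : CommutativeRing c ℓ) →
    let open CommutativeRing R in
    (m : ℕ) (as : Vec Carrier (suc m)) (ε : Carrier) →
    (ε ≈ 1# ⊎ ε ≈ - 1#) →
    K R as ≈ ε →
    _≈M_ R (M R ((ε * K R (tail as)) ∷ (as ++ [ ε * K R (init as) ])))
    (scaleM R (- ε) (idM R))
lemma2p15 R _ (a ∷ v) ε ε≈±1 K≈ε = begin
  M R (x ∷ (as ++ [ y ]))       ≈⟨ ·-cong (M-snoc as y) ≃-refl ⟩
  E R y · M R as · E R x        ≈⟨ ·-assoc (E R y) (M R as) (E R x) ⟩
  E R y · (M R as · E R x)      ≈⟨ ·-cong ≃-refl N·Ex≃ ⟩
  E R y · mat 0# (- ε) ε (- l)  ≈⟨ E-·-antidiagonal εε≈1 l ⟩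
  scaleM R (- ε) (idM R)        ∎
  where
  open CommutativeRing R using (_*_; -_; 0#; trans)
  open Continuants R
  open SetoidReasoning Mat2-setoid
  as = a ∷ v
  l = K R (init as)
  x = ε * K R v
  y = ε * l
  εε≈1 = x≈±1⇒x*x≈1 ε≈±1
  N·Ex≃ = ·E-clearCorner εε≈1 (M R as) (detM-M as) (trans (M-m11 as) K≈ε) (M-m12 a v) (M-m21 as)
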